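{- Let $G=(V,E)$ be a graph and let $S_1,S_2\subseteq V$ be nonempty with $S_1\cup S_2=V$, such that there is no vertex $u\in S_2$ with $N[u]\cap S_1=S_1$. Let $b^*=\mathrm{box}(G)$, let $t$ be an integer with $1\le t\le|S_1|$, let $\beta_t=\beta_t(S_1,S_2)$, let $t^*=|S_2|\bigl(1-2b^*(1-\beta_t)\bigr)$ and let $\alpha^*=\alpha_{t^*}(S_2,S_1)$. Then $$\mathrm{box}(G)\ge\frac{1}{2\left(1-\beta_t+\frac{t-1}{\alpha^*|S_2|}\right)},$$ where $\frac{t-1}{\alpha^*|S_2|}$ is interpreted as $0$ when $\alpha^*=\infty$.
   Context: Graphs are finite, simple, undirected. The boxicity $\mathrm{box}(G)$ is the minimum $k$ such that there are interval graphs $I_1,\dots,I_k$ on $V$ with $E(G)=E(I_1)\cap\cdots\cap E(I_k)$. For $X\subseteq V$ and a graph $H$ on $V$, $N'(X,H)=\{u : \exists v\in X,\ uv\in E(H)\}$ and $N[X,H]=X\cup N'(X,H)$; $N[u]=N[\{u\},G]$. $\overline{G}$ is the complement of $G$. Cross expansion: for $A,B\subseteq V$ and an integer $1\le t\le|A|$, let $n_t=\min_{S\subseteq A,|S|=t}|N[S,G]\cap B|$ and $\beta_t(A,B)=n_t/|B|$. Co-expansion: for $A,B\subseteq V$ and a positive integer $t\le|A|$, let $m_t=\min_{S\subseteq A,|S|=t}|N'(S,\overline{G})\cap B|$ and $\alpha_t(A,B)=m_t/t$; for $t\le 0$ set $\alpha_t(A,B)=\infty$. (Note $t^*$ is an integer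 not exceeding $|S_2|$.) -}

module Defs where

open import Data.Bool using (Bool; true; false; _∧_; _∨_; not)
open import Data.Nat as ℕ using (ℕ; zero; suc)
open import Data.Integer as ℤ using (ℤ; +_)
open import Data.Rational as ℚ using (ℚ; 0ℚ)
open import Data.Rational.Properties using (_≟_)
open import Data.Fin using (Fin; zero; suc; _≟_)
open import Data.Fin.Subset using (Subset; _∈_; _⊆_; _∩_; ∣_∣)
open import Data.Vec using (Vec; lookup; tabulate)
open import Data.Product using (Σ; ∃; _×_; _,_)
open import Relation.Nullary using (¬_; yes; no; does)
open import Relation.Binary.PropositionalEquality using (_≡_; _≢_)
open import Data.Empty using (⊥)
open import Data.Unit using (⊤)

record Graph (n : ℕ) : Set where
  field
    adj    : Fin n → Fin n → Bool
    sym    : ∀ u v → adj u v ≡ adj v u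
    irrefl : ∀ u → adj u u ≡ false
open Graph public

anyFin : ∀ {n} → (Fin n → Bool) → Bool
anyFin {zero}  f = false
anyFin {suc n} f = f zero ∨ anyFin (λ i → f (suc i))

coAdj : ∀ {n} → Graph n → Fin n → Fin n → Bool
coAdj G u v = not (adj G u v) ∧ not (does (u Data.Fin.≟ v))

N′ : ∀ {n} → Graph n → Subset n → Subset n
N′ G X = tabulate (λ u → anyFin (λ v → lookup X v ∧ adj G u v))

N[_,_] : ∀ {n} → Subset n → Graph n → Subset n
N[ X , G ] = tabulate (λ u → lookup X u ∨ lookup (N′ G X) u)

N′co : ∀ {n} → Graph n → Subset n → Subset n
N′co G X = tabulate (λ u → anyFin (λ v → lookup X v ∧ coAdj G u v))

-- An interval representation assigns to each vertex a closed interval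
-- [l , r] of rationals (l ≤ r); the interval graph it defines has an edge
-- between distinct u, v iff their intervals intersect.

record IntervalRep (n : ℕ) : Set where
  field
    left  : Fin n → ℚ
    right : Fin n → ℚ
    wf    : ∀ u → left u ℚ.≤ right u
open IntervalRep public

IEdge : ∀ {n} → IntervalRep n → Fin n → Fin n → Set
IEdge I u v = (left I u ℚ.≤ right I v) × (left I v ℚ.≤ right I u)

HasBoxRep : ∀ {n} → Graph n → ℕ → Set
HasBoxRep {n} G k =
  Σ (Fin k → IntervalRep n) λ I →
    ∀ u v → u ≢ v → (adj G u v ≡ true → ∀ i → IEdge (I i) u v)
                   × ((∀ i → IEdge (I i) u v) → adj G u v ≡ true)

IsBoxicity : ∀ {n} → Graph n → ℕ → Set
IsBoxicity G b = HasBoxRep G b × (∀ k → k ℕ.< b → ¬ HasBoxRep G k)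

IsMinCross : ∀ {n} → Graph n → Subset n → Subset n → ℕ → ℕ → Set
IsMinCross G A B t nt =
  (∃ λ S → S ⊆ A × ∣ S ∣ ≡ t × ∣ N[ S , G ] ∩ B ∣ ≡ nt)
  × (∀ S → S ⊆ A → ∣ S ∣ ≡ t → nt ℕ.≤ ∣ N[ S , G ] ∩ B ∣)

IsMinCo : ∀ {n} → Graph n → Subset n → Subset n → ℕ → ℕ → Set
IsMinCo G A B t mt =
  (∃ λ S → S ⊆ A × ∣ S ∣ ≡ t × ∣ N′co G S ∩ B ∣ ≡ mt)
  × (∀ S → S ⊆ A → ∣ S ∣ ≡ t → mt ℕ.≤ ∣ N′co G S ∩ B ∣)

ℕtoℚ : ℕ → ℚ
ℕtoℚ k = (+ k) ℚ./ 1

ℤtoℚ : ℤ → ℚ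
ℤtoℚ z = z ℚ./ 1

-- total division (x ÷₀ 0 = 0); only ever applied to nonzero divisors
-- in the statement
_÷₀_ : ℚ → ℚ → ℚ
p ÷₀ q with q Data.Rational.Properties.≟ 0ℚ
... | yes _  = 0ℚ
... | no q≢0 = ℚ._÷_ p q {{ℚ.≢-nonZero q≢0}}

-- ℚ extended by +∞ (used for α_t, which is ∞ when t ≤ 0)
data ℚ∞ : Set where
  fin : ℚ → ℚ∞
  ∞   : ℚ∞

IsBeta : ∀ {n} → Graph n → Subset n → Subset n → ℕ → ℚ → Set
IsBeta G A B t β = ∃ λ nt → IsMinCross G A B t nt × β ≡ ℕtoℚ nt ÷₀ ℕtoℚ ∣ B ∣

IsAlpha : ∀ {n} → Graph n → Subset n → Subset n → ℤ → ℚ∞ → Set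
IsAlpha G A B (+ zero)  a = a ≡ ∞
IsAlpha G A B ℤ.-[1+ _ ] a = a ≡ ∞
IsAlpha G A B (+ suc k) a =
  ∃ λ mt → IsMinCo G A B (suc k) mt × a ≡ fin (ℕtoℚ mt ÷₀ ℕtoℚ (suc k))

extraTerm : ℕ → ℚ∞ → ℕ → ℚ
extraTerm t ∞       s2 = 0ℚ
extraTerm t (fin α) s2 = ℕtoℚ (t ℕ.∸ 1) ÷₀ (α ℚ.* ℕtoℚ s2)

module Submission where

-- Let s = |S₂|, t = t′ + 1, d = s - nₜ (so β = nₜ/s) and fix a
-- representation of G as the intersection of b interval graphs.  In one
-- interval graph, let C be the t vertices of S₁ with the largest left
-- endpoints.  Every vertex of N[C] reaches, with its right endpoint, the left
-- endpoint of every vertex of S₁ except the t - 1 upper vertices of C, and by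
-- definition of nₜ at most d vertices of S₂ lie outside N[C].  The same holds
-- for right endpoints (reflect the line); over all b interval graphs, all but
-- 2bd vertices of S₂ are adjacent to all but 2b(t - 1) vertices of S₁.  If
-- t* = s - 2bd is positive, some t*-subset of S₂ therefore has all its
-- non-neighbours in S₁ among 2b(t - 1) vertices: m_{t*} ≤ 2b(t - 1), while
-- m_{t*} ≥ 1 since no vertex of S₂ dominates S₁.  The stated bound is then
-- rational arithmetic, and for t* ≤ 0 it is immediate.

module Arithmetic where

  open import Defs using (ℕtoℚ; _÷₀_)
  open import Data.Nat as ℕ using (ℕ; _∸_)
  import Data.Nat.Properties as ℕP
  import Data.Nat.Coprimality as Coprimality
  open import Data.Integer as ℤ using (+_; +≤+; +<+)
  import Data.Integer.Properties as ℤP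
  open import Data.Rational as ℚ
    using (ℚ; mkℚ; ↥_; 0ℚ; 1ℚ; _+_; _-_; _*_; _÷_; _≤_; _<_; *≤*; *<*)
  import Data.Rational.Properties as ℚP
  open import Data.Maybe using (Maybe; just; nothing)
  open import Level using (0ℓ)
  open import Relation.Nullary using (yes; no; contradiction)
  open import Relation.Binary.PropositionalEquality
  open import Tactic.RingSolver using (solve-∀)
  open import Tactic.RingSolver.Core.AlmostCommutativeRing
    using (AlmostCommutativeRing; fromCommutativeRing)

  ℚ-ring : AlmostCommutativeRing 0ℓ 0ℓ
  ℚ-ring = fromCommutativeRing ℚP.+-*-commutativeRing isZero
    where
    isZero : ∀ x → Maybe (0ℚ ≡ x)
    isZero x with 0ℚ ℚP.≟ x
    ... | yes 0≡x = just 0≡x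
    ... | no _    = nothing

  -- ℕtoℚ is an injective, order-preserving semiring homomorphism; all
  -- of this is read off its normal form k/1.
  ℕtoℚ-mkℚ : ∀ k → ℕtoℚ k ≡ mkℚ (+ k) 0 (Coprimality.sym (Coprimality.1-coprimeTo k))
  ℕtoℚ-mkℚ k = ℚP.normalize-coprime _

  ℕtoℚ-injective : ∀ {a b} → ℕtoℚ a ≡ ℕtoℚ b → a ≡ b
  ℕtoℚ-injective {a} {b} eq =
    ℤP.+-injective (cong ↥_ (trans (sym (ℕtoℚ-mkℚ a)) (trans eq (ℕtoℚ-mkℚ b))))

  ℕtoℚ-+ : ∀ a b → ℕtoℚ (a ℕ.+ b) ≡ ℕtoℚ a + ℕtoℚ b
  ℕtoℚ-+ a b rewrite ℕtoℚ-mkℚ a | ℕtoℚ-mkℚ b | ℤP.*-identityʳ (+ a) | ℤP.*-identityʳ (+ b) =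
    cong (ℚ._/ 1) (ℤP.pos-+ a b)

  ℕtoℚ-* : ∀ a b → ℕtoℚ (a ℕ.* b) ≡ ℕtoℚ a * ℕtoℚ b
  ℕtoℚ-* a b rewrite ℕtoℚ-mkℚ a | ℕtoℚ-mkℚ b = cong (ℚ._/ 1) (ℤP.pos-* a b)

  ℕtoℚ-mono-≤ : ∀ {a b} → a ℕ.≤ b → ℕtoℚ a ≤ ℕtoℚ b
  ℕtoℚ-mono-≤ {a} {b} a≤b rewrite ℕtoℚ-mkℚ a | ℕtoℚ-mkℚ b =
    *≤* (subst₂ ℤ._≤_ (sym (ℤP.*-identityʳ (+ a))) (sym (ℤP.*-identityʳ (+ b))) (+≤+ a≤b))

  ℕtoℚ-mono-< : ∀ {a b} → a ℕ.< b → ℕtoℚ a < ℕtoℚ b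
  ℕtoℚ-mono-< {a} {b} a<b rewrite ℕtoℚ-mkℚ a | ℕtoℚ-mkℚ b =
    *<* (subst₂ ℤ._<_ (sym (ℤP.*-identityʳ (+ a))) (sym (ℤP.*-identityʳ (+ b))) (+<+ a<b))

  ℕtoℚ-nonneg : ∀ a → 0ℚ ≤ ℕtoℚ a
  ℕtoℚ-nonneg a = ℕtoℚ-mono-≤ {0} {a} ℕ.z≤n

  ℕtoℚ-∸ : ∀ {a b} → a ℕ.≤ b → ℕtoℚ (b ∸ a) ≡ ℕtoℚ b - ℕtoℚ a
  ℕtoℚ-∸ {a} {b} a≤b = begin
    ℕtoℚ (b ∸ a)                     ≡⟨ cancel (ℕtoℚ a) (ℕtoℚ (b ∸ a)) ⟩
    (ℕtoℚ a + ℕtoℚ (b ∸ a)) - ℕtoℚ a ≡⟨ cong (_- ℕtoℚ a) (sym (ℕtoℚ-+ a (b ∸ a))) ⟩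
    ℕtoℚ (a ℕ.+ (b ∸ a)) - ℕtoℚ a    ≡⟨ cong (λ x → ℕtoℚ x - ℕtoℚ a) (ℕP.m+[n∸m]≡n a≤b) ⟩
    ℕtoℚ b - ℕtoℚ a                  ∎
    where
    open ≡-Reasoning
    cancel : ∀ x y → y ≡ (x + y) - x
    cancel = solve-∀ ℚ-ring

  ÷₀-nonzero : ∀ p {q} (q≢0 : q ≢ 0ℚ) → p ÷₀ q ≡ (p ÷ q) {{ℚ.≢-nonZero q≢0}}
  ÷₀-nonzero p {q} q≢0 with q ℚP.≟ 0ℚ
  ... | yes q≡0 = contradiction q≡0 q≢0
  ... | no _    = refl

  ÷₀-cancel : ∀ p {q} → q ≢ 0ℚ → (p ÷₀ q) * q ≡ p
  ÷₀-cancel p {q} q≢0 = begin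
    (p ÷₀ q) * q        ≡⟨ cong (_* q) (÷₀-nonzero p q≢0) ⟩
    (p * ℚ.1/ q) * q    ≡⟨ ℚP.*-assoc p (ℚ.1/ q) q ⟩
    p * (ℚ.1/ q * q)    ≡⟨ cong (p *_) (ℚP.*-inverseˡ q) ⟩
    p * 1ℚ              ≡⟨ ℚP.*-identityʳ p ⟩
    p                   ∎
    where
    open ≡-Reasoning
    instance _ = ℚ.≢-nonZero q≢0

  >⇒≢0 : ∀ {q} → 0ℚ < q → q ≢ 0ℚ
  >⇒≢0 0<q q≡0 = ℚP.<-irrefl (sym q≡0) 0<q

  ÷₀-pos : ∀ {p q} → 0ℚ < p → 0ℚ < q → 0ℚ < p ÷₀ q
  ÷₀-pos {p} {q} 0<p 0<q = ℚP.≰⇒> λ p÷q≤0 → ℚP.<-irrefl refl (ℚP.<-≤-trans 0<p (p≤0 p÷q≤0))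
    where
    p≤0 : p ÷₀ q ≤ 0ℚ → p ≤ 0ℚ
    p≤0 p÷q≤0 = subst₂ _≤_ (÷₀-cancel p (>⇒≢0 0<q)) (ℚP.*-zeroˡ q)
      (ℚP.*-monoʳ-≤-nonNeg q {{ℚ.nonNegative (ℚP.<⇒≤ 0<q)}} p÷q≤0)

  *-pos : ∀ {p q} → 0ℚ < p → 0ℚ < q → 0ℚ < p * q
  *-pos {p} {q} 0<p 0<q =
    ℚP.positive⁻¹ (p * q) {{ℚP.pos*pos⇒pos p {{ℚ.positive 0<p}} q {{ℚ.positive 0<q}}}}

  -- 1 ÷₀ D ≤ B as soon as 1 ≤ B * D with B ≥ 0 (which forces D > 0).
  ÷₀-lower-bound : ∀ {B D} → 0ℚ ≤ B → 1ℚ ≤ B * D → 1ℚ ÷₀ D ≤ B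
  ÷₀-lower-bound {B} {D} 0≤B 1≤BD =
    ℚP.*-cancelʳ-≤-pos D {{ℚ.positive 0<D}}
      (subst (_≤ B * D) (sym (÷₀-cancel 1ℚ (>⇒≢0 0<D))) 1≤BD)
    where
    BD≤0 : D ≤ 0ℚ → B * D ≤ 0ℚ
    BD≤0 D≤0 = subst (B * D ≤_) (ℚP.*-zeroʳ B) (ℚP.*-monoˡ-≤-nonNeg B {{ℚ.nonNegative 0≤B}} D≤0)
    0<D : 0ℚ < D
    0<D = ℚP.≰⇒> λ D≤0 →
      ℚP.<-irrefl refl (ℚP.<-≤-trans (ℚP.positive⁻¹ 1ℚ) (ℚP.≤-trans 1≤BD (BD≤0 D≤0)))

  ℕtoℚ-*-double : ∀ b d → ℕtoℚ (b ℕ.* (d ℕ.+ d)) ≡ ℕtoℚ 2 * ℕtoℚ b * ℕtoℚ d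
  ℕtoℚ-*-double b d = begin
    ℕtoℚ (b ℕ.* (d ℕ.+ d))        ≡⟨ ℕtoℚ-* b (d ℕ.+ d) ⟩
    ℕtoℚ b * ℕtoℚ (d ℕ.+ d)       ≡⟨ cong (ℕtoℚ b *_) (ℕtoℚ-+ d d) ⟩
    ℕtoℚ b * (ℕtoℚ d + ℕtoℚ d)    ≡⟨ double (ℕtoℚ b) (ℕtoℚ d) ⟩
    ℕtoℚ 2 * ℕtoℚ b * ℕtoℚ d      ∎
    where
    open ≡-Reasoning
    double : ∀ x y → x * (y + y) ≡ (1ℚ + 1ℚ) * x * y
    double = solve-∀ ℚ-ring

  tstar-natural : ∀ k s b nt β → nt ℕ.≤ s → β * ℕtoℚ s ≡ ℕtoℚ nt →
    ℕtoℚ k ≡ ℕtoℚ s * (1ℚ - ℕtoℚ 2 * ℕtoℚ b * (1ℚ - β)) →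
    k ℕ.+ b ℕ.* ((s ∸ nt) ℕ.+ (s ∸ nt)) ≡ s
  tstar-natural k s b nt β nt≤s βs≡nt k≡ = ℕtoℚ-injective (begin
    ℕtoℚ (k ℕ.+ b ℕ.* (d ℕ.+ d))          ≡⟨ ℕtoℚ-+ k (b ℕ.* (d ℕ.+ d)) ⟩
    ℕtoℚ k + ℕtoℚ (b ℕ.* (d ℕ.+ d))        ≡⟨ cong₂ _+_ k≡ (ℕtoℚ-*-double b d) ⟩
    S * deficit + ℕtoℚ 2 * B * ℕtoℚ d      ≡⟨ cong (λ x → S * deficit + ℕtoℚ 2 * B * x) d≡ ⟩
    S * deficit + ℕtoℚ 2 * B * (S - β * S) ≡⟨ balance (ℕtoℚ 2) S B β ⟩
    S                                      ∎)
    where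
    open ≡-Reasoning
    d : ℕ
    d = s ∸ nt
    S B deficit : ℚ
    S = ℕtoℚ s
    B = ℕtoℚ b
    deficit = 1ℚ - ℕtoℚ 2 * B * (1ℚ - β)
    d≡ : ℕtoℚ d ≡ S - β * S
    d≡ = trans (ℕtoℚ-∸ nt≤s) (cong (S -_) (sym βs≡nt))
    balance : ∀ c x y z → x * (1ℚ - c * y * (1ℚ - z)) + c * y * (x - z * x) ≡ x
    balance = solve-∀ ℚ-ring

  -- The inequality box(G) ≥ 1/(2(1 - β + E)) follows once the deficit
  -- 1 - 2b(1 - β) is at most 2bE.
  deficit-covered : ∀ B β {E} → 1ℚ - ℕtoℚ 2 * B * (1ℚ - β) ≤ ℕtoℚ 2 * B * E →
    1ℚ ≤ B * (ℕtoℚ 2 * (1ℚ - β + E))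
  deficit-covered B β {E} h =
    subst₂ _≤_ (restore (ℕtoℚ 2) B β) (regroup (ℕtoℚ 2) B β E)
      (ℚP.+-monoˡ-≤ (ℕtoℚ 2 * B * (1ℚ - β)) h)
    where
    restore : ∀ c x y → (1ℚ - c * x * (1ℚ - y)) + c * x * (1ℚ - y) ≡ 1ℚ
    restore = solve-∀ ℚ-ring
    regroup : ∀ c x y z → c * x * z + c * x * (1ℚ - y) ≡ x * (c * (1ℚ - y + z))
    regroup = solve-∀ ℚ-ring

  nonpos-factor : ∀ {s c} x → 0ℚ < s → s * c ≤ 0ℚ → c ≤ x * 0ℚ
  nonpos-factor {s} {c} x 0<s sc≤0 = ℚP.*-cancelˡ-≤-pos s {{ℚ.positive 0<s}}
    (subst (s * c ≤_) (trans (sym (ℚP.*-zeroʳ s)) (cong (s *_) (sym (ℚP.*-zeroʳ x)))) sc≤0)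

  ≤-*÷₀ : ∀ {a c} X T → 0ℚ < a → a * c ≤ X * T → c ≤ X * (T ÷₀ a)
  ≤-*÷₀ {a} {c} X T 0<a ac≤XT =
    ℚP.*-cancelˡ-≤-pos a {{ℚ.positive 0<a}} (subst (a * c ≤_) XT≡ ac≤XT)
    where
    open ≡-Reasoning
    shuffle : ∀ x y z → x * (y * z) ≡ z * (x * y)
    shuffle = solve-∀ ℚ-ring
    XT≡ : X * T ≡ a * (X * (T ÷₀ a))
    XT≡ = begin
      X * T              ≡⟨ cong (X *_) (sym (÷₀-cancel T (>⇒≢0 0<a))) ⟩
      X * ((T ÷₀ a) * a) ≡⟨ shuffle X (T ÷₀ a) a ⟩
      a * (X * (T ÷₀ a)) ∎

  deficit-by-quotient : ∀ {s c K M} X T → 0ℚ < s → 0ℚ < K → 0ℚ < M →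
    K ≡ s * c → M ≤ X * T → c ≤ X * (T ÷₀ ((M ÷₀ K) * s))
  deficit-by-quotient {s} {c} {K} {M} X T 0<s 0<K 0<M K≡sc M≤XT =
    ≤-*÷₀ X T (*-pos (÷₀-pos 0<M 0<K) 0<s) (subst (_≤ X * T) (sym αsc≡M) M≤XT)
    where
    open ≡-Reasoning
    α : ℚ
    α = M ÷₀ K
    αsc≡M : α * s * c ≡ M
    αsc≡M = begin
      α * s * c   ≡⟨ ℚP.*-assoc α s c ⟩
      α * (s * c) ≡⟨ cong (α *_) (sym K≡sc) ⟩
      α * K       ≡⟨ ÷₀-cancel M (>⇒≢0 0<K) ⟩
      M           ∎


module Subsets where

  open import Defs using (anyFin)
  open import Data.Bool using (Bool; true; false; _∧_; _∨_)
  open import Data.Bool.Properties using (∧-conicalˡ; ∧-conicalʳ)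
  open import Level using (Level)
  open import Data.Nat using (ℕ; zero; suc; _+_; _*_; _≤_; z≤n; s≤s)
  import Data.Nat.Properties as ℕP
  open import Data.Fin using (Fin; zero; suc)
  open import Data.Fin.Subset
    using (Subset; _∈_; _∉_; _⊆_; _∩_; _∪_; ⊥; ⁅_⁆; ∁; ∣_∣; Nonempty; inside; outside)
  open import Data.Fin.Subset.Properties
  open import Data.Vec using ([]; _∷_; here; there; lookup; tabulate)
  import Data.Vec.Properties as VecP
  open import Data.Product using (∃; _×_; _,_)
  open import Data.Sum using (_⊎_; inj₁; inj₂)
  open import Data.Empty using (⊥-elim)
  open import Function using (_∘_)
  open import Relation.Binary.PropositionalEquality

  private variable
    n : ℕ
    ℓ : Level

  ∣p∪q∣≤∣p∣+∣q∣ : ∀ (p q : Subset n) → ∣ p ∪ q ∣ ≤ ∣ p ∣ + ∣ q ∣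
  ∣p∪q∣≤∣p∣+∣q∣ []            []            = z≤n
  ∣p∪q∣≤∣p∣+∣q∣ (inside ∷ p)  (inside ∷ q)  =
    s≤s (ℕP.≤-trans (∣p∪q∣≤∣p∣+∣q∣ p q) (ℕP.+-monoʳ-≤ ∣ p ∣ (ℕP.n≤1+n ∣ q ∣)))
  ∣p∪q∣≤∣p∣+∣q∣ (inside ∷ p)  (outside ∷ q) = s≤s (∣p∪q∣≤∣p∣+∣q∣ p q)
  ∣p∪q∣≤∣p∣+∣q∣ (outside ∷ p) (inside ∷ q)  =
    ℕP.≤-trans (s≤s (∣p∪q∣≤∣p∣+∣q∣ p q)) (ℕP.≤-reflexive (sym (ℕP.+-suc ∣ p ∣ ∣ q ∣)))
  ∣p∪q∣≤∣p∣+∣q∣ (outside ∷ p) (outside ∷ q) = ∣p∪q∣≤∣p∣+∣q∣ p q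

  ∣q∣≡∣p∩q∣+∣∁p∩q∣ : ∀ (p q : Subset n) → ∣ q ∣ ≡ ∣ p ∩ q ∣ + ∣ ∁ p ∩ q ∣
  ∣q∣≡∣p∩q∣+∣∁p∩q∣ []            []            = refl
  ∣q∣≡∣p∩q∣+∣∁p∩q∣ (inside ∷ p)  (inside ∷ q)  = cong suc (∣q∣≡∣p∩q∣+∣∁p∩q∣ p q)
  ∣q∣≡∣p∩q∣+∣∁p∩q∣ (outside ∷ p) (inside ∷ q)  =
    trans (cong suc (∣q∣≡∣p∩q∣+∣∁p∩q∣ p q)) (sym (ℕP.+-suc ∣ p ∩ q ∣ ∣ ∁ p ∩ q ∣))
  ∣q∣≡∣p∩q∣+∣∁p∩q∣ (inside ∷ p)  (outside ∷ q) = ∣q∣≡∣p∩q∣+∣∁p∩q∣ p q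
  ∣q∣≡∣p∩q∣+∣∁p∩q∣ (outside ∷ p) (outside ∷ q) = ∣q∣≡∣p∩q∣+∣∁p∩q∣ p q

  ∣q∣≤∣p∣+∣∁p∩q∣ : ∀ (p q : Subset n) → ∣ q ∣ ≤ ∣ p ∣ + ∣ ∁ p ∩ q ∣
  ∣q∣≤∣p∣+∣∁p∩q∣ p q =
    ℕP.≤-trans (ℕP.≤-reflexive (∣q∣≡∣p∩q∣+∣∁p∩q∣ p q)) (ℕP.+-monoˡ-≤ ∣ ∁ p ∩ q ∣ (∣p∩q∣≤∣p∣ p q))

  ∣p∪⁅x⁆∣≡1+∣p∣ : ∀ {p : Subset n} {x} → x ∉ p → ∣ p ∪ ⁅ x ⁆ ∣ ≡ suc ∣ p ∣
  ∣p∪⁅x⁆∣≡1+∣p∣ {p = outside ∷ p} {zero}  x∉p = cong (λ q → suc ∣ q ∣) (∪-identityʳ p)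
  ∣p∪⁅x⁆∣≡1+∣p∣ {p = inside ∷ p}  {zero}  x∉p = ⊥-elim (x∉p here)
  ∣p∪⁅x⁆∣≡1+∣p∣ {p = inside ∷ p}  {suc x} x∉p = cong suc (∣p∪⁅x⁆∣≡1+∣p∣ (x∉p ∘ there))
  ∣p∪⁅x⁆∣≡1+∣p∣ {p = outside ∷ p} {suc x} x∉p = ∣p∪⁅x⁆∣≡1+∣p∣ (x∉p ∘ there)

  ∈⁅⁆-elim : ∀ {P : Fin n → Set ℓ} {x y} → x ∈ ⁅ y ⁆ → P y → P x
  ∈⁅⁆-elim {P = P} {y = y} x∈⁅y⁆ = subst P (sym (x∈⁅y⁆⇒x≡y y x∈⁅y⁆))

  x∈p⇒1≤∣p∣ : ∀ {p : Subset n} {x} → x ∈ p → 1 ≤ ∣ p ∣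
  x∈p⇒1≤∣p∣ {p = p} {x} x∈p =
    subst (_≤ ∣ p ∣) (∣⁅x⁆∣≡1 x) (p⊆q⇒∣p∣≤∣q∣ λ y∈⁅x⁆ → ∈⁅⁆-elim {P = _∈ p} y∈⁅x⁆ x∈p)

  1≤∣p∣⇒nonempty : ∀ (p : Subset n) → 1 ≤ ∣ p ∣ → Nonempty p
  1≤∣p∣⇒nonempty (inside ∷ p)  _   = zero , here
  1≤∣p∣⇒nonempty (outside ∷ p) 1≤∣p∣ with 1≤∣p∣⇒nonempty p 1≤∣p∣
  ... | x , x∈p = suc x , there x∈p

  subsetOfSize : ∀ (p : Subset n) m → m ≤ ∣ p ∣ → ∃ λ S → S ⊆ p × ∣ S ∣ ≡ m
  subsetOfSize {n} p zero _ = ⊥ , ⊥-elim ∘ ∉⊥ , ∣⊥∣≡0 n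
  subsetOfSize (inside ∷ p) (suc m) (s≤s m≤∣p∣) with subsetOfSize p m m≤∣p∣
  ... | S , S⊆p , ∣S∣≡m = inside ∷ S , s⊆s S⊆p , cong suc ∣S∣≡m
  subsetOfSize (outside ∷ p) (suc m) m<∣p∣ with subsetOfSize p (suc m) m<∣p∣
  ... | S , S⊆p , ∣S∣≡m = outside ∷ S , out⊆ S⊆p , ∣S∣≡m

  ⋃ᶠ : ∀ k → (Fin k → Subset n) → Subset n
  ⋃ᶠ zero    f = ⊥
  ⋃ᶠ (suc k) f = f zero ∪ ⋃ᶠ k (f ∘ suc)

  ⊆⋃ᶠ : ∀ k (f : Fin k → Subset n) i → f i ⊆ ⋃ᶠ k f
  ⊆⋃ᶠ (suc k) f zero    = p⊆p∪q (⋃ᶠ k (f ∘ suc))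
  ⊆⋃ᶠ (suc k) f (suc i) = q⊆p∪q (f zero) (⋃ᶠ k (f ∘ suc)) ∘ ⊆⋃ᶠ k (f ∘ suc) i

  ∣⋃ᶠ∣≤ : ∀ k (f : Fin k → Subset n) {c} → (∀ i → ∣ f i ∣ ≤ c) → ∣ ⋃ᶠ k f ∣ ≤ k * c
  ∣⋃ᶠ∣≤ {n} zero    f _      = ℕP.≤-reflexive (∣⊥∣≡0 n)
  ∣⋃ᶠ∣≤ (suc k) f ∣fi∣≤c = ℕP.≤-trans (∣p∪q∣≤∣p∣+∣q∣ (f zero) (⋃ᶠ k (f ∘ suc)))
    (ℕP.+-mono-≤ (∣fi∣≤c zero) (∣⋃ᶠ∣≤ k (f ∘ suc) (∣fi∣≤c ∘ suc)))

  ∧-true⁺ : ∀ {a b} → a ≡ true → b ≡ true → a ∧ b ≡ true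
  ∧-true⁺ refl refl = refl

  ∧-true⁻ : ∀ {a b} → a ∧ b ≡ true → a ≡ true × b ≡ true
  ∧-true⁻ {a} {b} a∧b = ∧-conicalˡ a b a∧b , ∧-conicalʳ a b a∧b

  ∨-trueˡ : ∀ {a} b → a ≡ true → a ∨ b ≡ true
  ∨-trueˡ b refl = refl

  ∨-trueʳ : ∀ a {b} → b ≡ true → a ∨ b ≡ true
  ∨-trueʳ true  _      = refl
  ∨-trueʳ false b≡true = b≡true

  ∨-true⁻ : ∀ {a b} → a ∨ b ≡ true → a ≡ true ⊎ b ≡ true
  ∨-true⁻ {true}  _      = inj₁ refl
  ∨-true⁻ {false} b≡true = inj₂ b≡true

  anyFin-true⁺ : ∀ (f : Fin n → Bool) i → f i ≡ true → anyFin f ≡ true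
  anyFin-true⁺ f zero    fi = ∨-trueˡ (anyFin (f ∘ suc)) fi
  anyFin-true⁺ f (suc i) fi = ∨-trueʳ (f zero) (anyFin-true⁺ (f ∘ suc) i fi)

  anyFin-true⁻ : ∀ (f : Fin n → Bool) → anyFin f ≡ true → ∃ λ i → f i ≡ true
  anyFin-true⁻ {suc n} f any with ∨-true⁻ {f zero} any
  ... | inj₁ f0 = zero , f0
  ... | inj₂ rest with anyFin-true⁻ (f ∘ suc) rest
  ...   | i , fi = suc i , fi

  ∈-tabulate⁺ : ∀ {f : Fin n → Bool} {x} → f x ≡ true → x ∈ tabulate f
  ∈-tabulate⁺ {f = f} {x} fx =
    VecP.lookup⇒[]= x (tabulate f) (trans (VecP.lookup∘tabulate f x) fx)

  ∈-tabulate⁻ : ∀ {f : Fin n → Bool} {x} → x ∈ tabulate f → f x ≡ true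
  ∈-tabulate⁻ {f = f} {x} x∈ = trans (sym (VecP.lookup∘tabulate f x)) (VecP.[]=⇒lookup x∈)

  -- The elements having an R-partner in X.  The neighbourhoods N′ and N′co
  -- of Defs are (definitionally) of this form.
  Partners : (Fin n → Fin n → Bool) → Subset n → Subset n
  Partners R X = tabulate (λ u → anyFin (λ v → lookup X v ∧ R u v))

  ∈Partners⁺ : ∀ R {X : Subset n} {u v} → v ∈ X → R u v ≡ true → u ∈ Partners R X
  ∈Partners⁺ R {X} {u} {v} v∈X Ruv =
    ∈-tabulate⁺ (anyFin-true⁺ (λ w → lookup X w ∧ R u w) v (∧-true⁺ (VecP.[]=⇒lookup v∈X) Ruv))

  ∈Partners⁻ : ∀ R {X : Subset n} {u} → u ∈ Partners R X → ∃ λ v → v ∈ X × R u v ≡ true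
  ∈Partners⁻ R {X} {u} u∈ with anyFin-true⁻ (λ w → lookup X w ∧ R u w) (∈-tabulate⁻ u∈)
  ... | v , Xv∧Ruv with ∧-true⁻ Xv∧Ruv
  ...   | Xv , Ruv = v , VecP.lookup⇒[]= v X Xv , Ruv


module TopSelections where

  open Subsets
  open import Data.Nat using (ℕ; zero; suc; _+_; _≤_)
  import Data.Nat.Properties as ℕP
  open import Data.Fin using (Fin; zero; suc)
  open import Data.Fin.Subset
    using (Subset; _∈_; _∉_; _⊆_; _∩_; _∪_; ∁; ⊥; ⁅_⁆; ∣_∣; Nonempty; inside; outside)
  open import Data.Fin.Subset.Properties
  open import Data.Vec using (_∷_; here; there)
  open import Data.Product using (∃; _×_; _,_; proj₁; proj₂)
  open import Function using (_∘_)
  open import Data.Sum using (inj₁; inj₂; reduce; [_,_]′)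
  open import Data.Empty using (⊥-elim)
  open import Relation.Binary using (Rel; Total; Transitive)
  open import Relation.Nullary using (yes; no; contradiction)
  open import Relation.Binary.PropositionalEquality

  maximum : ∀ {n ℓ} (_≼_ : Rel (Fin n) ℓ) → Total _≼_ → Transitive _≼_ →
    (A : Subset n) → Nonempty A → ∃ λ y → y ∈ A × (∀ {w} → w ∈ A → w ≼ y)
  maximum _≼_ ≼-total ≼-trans (outside ∷ A) (suc x , there x∈A)
    with maximum (λ u v → suc u ≼ suc v) (λ u v → ≼-total (suc u) (suc v)) ≼-trans A (x , x∈A)
  ... | y , y∈A , max = suc y , there y∈A , λ { (there w∈A) → max w∈A }
  maximum _≼_ ≼-total ≼-trans (inside ∷ A) _ with nonempty? A
  ... | no A-empty = zero , here , λ
    { here → reduce (≼-total zero zero)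
    ; (there w∈A) → contradiction (_ , w∈A) A-empty }
  ... | yes A-nonempty
    with maximum (λ u v → suc u ≼ suc v) (λ u v → ≼-total (suc u) (suc v)) ≼-trans A A-nonempty
  ...   | y , y∈A , max with ≼-total zero (suc y)
  ...     | inj₁ 0≼y = suc y , there y∈A , λ { here → 0≼y ; (there w∈A) → max w∈A }
  ...     | inj₂ y≼0 = zero , here , λ
    { here → reduce (≼-total zero zero)
    ; (there w∈A) → ≼-trans (max w∈A) y≼0 }

  -- The m+1 largest elements `top` of A (ties broken arbitrarily) together
  -- with `upper`, the top elements other than the least one: every element
  -- of A outside `upper` lies below all of `top`.
  record TopSelection {n ℓ} (_≼_ : Rel (Fin n) ℓ) (A : Subset n) (m : ℕ) : Set ℓ where
    field
      top       : Subset n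
      upper     : Subset n
      top⊆A     : top ⊆ A
      ∣top∣≡    : ∣ top ∣ ≡ suc m
      upper⊆top : upper ⊆ top
      ∣upper∣≤  : ∣ upper ∣ ≤ m
      below-top : ∀ {w x} → w ∈ A → w ∉ upper → x ∈ top → w ≼ x

  -- Such a selection exists whenever A has at least m+1 elements: add
  -- greatest remaining elements one at a time.
  selectTop : ∀ {n ℓ} (_≼_ : Rel (Fin n) ℓ) → Total _≼_ → Transitive _≼_ →
    (A : Subset n) (m : ℕ) → suc m ≤ ∣ A ∣ → TopSelection _≼_ A m
  selectTop {n} _≼_ ≼-total ≼-trans A zero 1≤∣A∣
    with maximum _≼_ ≼-total ≼-trans A (1≤∣p∣⇒nonempty A 1≤∣A∣)
  ... | y , y∈A , max = record
    { top       = ⁅ y ⁆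
    ; upper     = ⊥
    ; top⊆A     = λ x∈⁅y⁆ → ∈⁅⁆-elim {P = _∈ A} x∈⁅y⁆ y∈A
    ; ∣top∣≡    = ∣⁅x⁆∣≡1 y
    ; upper⊆top = ⊥-elim ∘ ∉⊥
    ; ∣upper∣≤  = ℕP.≤-reflexive (∣⊥∣≡0 n)
    ; below-top = λ {w} w∈A _ x∈⁅y⁆ → ∈⁅⁆-elim {P = w ≼_} x∈⁅y⁆ (max w∈A)
    }
  selectTop {n} _≼_ ≼-total ≼-trans A (suc m) m+2≤∣A∣ =
    extend (selectTop _≼_ ≼-total ≼-trans A m (ℕP.≤-trans (ℕP.n≤1+n _) m+2≤∣A∣))
    where
    extend : TopSelection _≼_ A m → TopSelection _≼_ A (suc m)
    extend sel = record
      { top       = top ∪ ⁅ y ⁆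
      ; upper     = top
      ; top⊆A     = λ x∈ →
          [ top⊆A , (λ x∈⁅y⁆ → ∈⁅⁆-elim {P = _∈ A} x∈⁅y⁆ y∈A) ]′ (x∈p∪q⁻ top ⁅ y ⁆ x∈)
      ; ∣top∣≡    = trans (∣p∪⁅x⁆∣≡1+∣p∣ y∉top) (cong suc ∣top∣≡)
      ; upper⊆top = p⊆p∪q ⁅ y ⁆
      ; ∣upper∣≤  = ℕP.≤-reflexive ∣top∣≡
      ; below-top = below
      }
      where
      open TopSelection sel
      open ℕP.≤-Reasoning
      rest : Subset n
      rest = ∁ top ∩ A
      1≤∣rest∣ : 1 ≤ ∣ rest ∣
      1≤∣rest∣ = ℕP.+-cancelˡ-≤ (suc m) 1 ∣ rest ∣ (begin
        suc m + 1          ≡⟨ ℕP.+-comm (suc m) 1 ⟩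
        suc (suc m)        ≤⟨ m+2≤∣A∣ ⟩
        ∣ A ∣              ≤⟨ ∣q∣≤∣p∣+∣∁p∩q∣ top A ⟩
        ∣ top ∣ + ∣ rest ∣ ≡⟨ cong (_+ ∣ rest ∣) ∣top∣≡ ⟩
        suc m + ∣ rest ∣   ∎)
      greatestRest : ∃ λ y → y ∈ rest × (∀ {w} → w ∈ rest → w ≼ y)
      greatestRest = maximum _≼_ ≼-total ≼-trans rest (1≤∣p∣⇒nonempty rest 1≤∣rest∣)
      y : Fin n
      y = proj₁ greatestRest
      y∈rest : y ∈ rest
      y∈rest = proj₁ (proj₂ greatestRest)
      y∈A : y ∈ A
      y∈A = proj₂ (x∈p∩q⁻ (∁ top) A y∈rest)
      y∉top : y ∉ top
      y∉top = x∈∁p⇒x∉p (proj₁ (x∈p∩q⁻ (∁ top) A y∈rest))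
      below : ∀ {w x} → w ∈ A → w ∉ top → x ∈ top ∪ ⁅ y ⁆ → w ≼ x
      below w∈A w∉top x∈ with x∈p∪q⁻ top ⁅ y ⁆ x∈
      ... | inj₁ x∈top  = below-top w∈A (w∉top ∘ upper⊆top) x∈top
      ... | inj₂ x∈⁅y⁆ =
        ∈⁅⁆-elim {P = _ ≼_} x∈⁅y⁆ (proj₂ (proj₂ greatestRest) (x∈p∩q⁺ (x∉p⇒x∈∁p w∉top , w∈A)))


module Neighbourhoods where

  open import Defs using (Graph; adj; irrefl; coAdj; N′; N[_,_]; N′co)
  open Subsets
  open import Data.Bool using (true; false)
  open import Data.Nat using (ℕ)
  open import Data.Fin using (_≟_)
  open import Data.Fin.Subset using (_∈_)
  open import Data.Vec using (lookup)
  import Data.Vec.Properties as VecP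
  open import Data.Product using (∃; _×_; _,_)
  open import Data.Sum using (_⊎_; inj₁; inj₂)
  open import Relation.Nullary using (yes; no; contradiction)
  open import Relation.Binary.PropositionalEquality

  private variable
    n : ℕ

  ∈N[]⁻ : ∀ (G : Graph n) {C u} → u ∈ N[ C , G ] → u ∈ C ⊎ ∃ λ v → v ∈ C × adj G u v ≡ true
  ∈N[]⁻ G {C} {u} u∈N with ∨-true⁻ (∈-tabulate⁻ u∈N)
  ... | inj₁ Cu  = inj₁ (VecP.lookup⇒[]= u C Cu)
  ... | inj₂ N′u = inj₂ (∈Partners⁻ (adj G) (VecP.lookup⇒[]= u (N′ G C) N′u))

  ∈N[]-self : ∀ (G : Graph n) {C u} → u ∈ C → u ∈ N[ C , G ]
  ∈N[]-self G u∈C = ∈-tabulate⁺ (∨-trueˡ _ (VecP.[]=⇒lookup u∈C))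

  ∈N[]-adj : ∀ (G : Graph n) {C u v} → v ∈ C → adj G u v ≡ true → u ∈ N[ C , G ]
  ∈N[]-adj G {C} {u} v∈C uv =
    ∈-tabulate⁺ (∨-trueʳ (lookup C u) (VecP.[]=⇒lookup (∈Partners⁺ (adj G) v∈C uv)))

  coAdj-true⁺ : ∀ (G : Graph n) {u v} → adj G u v ≡ false → u ≢ v → coAdj G u v ≡ true
  coAdj-true⁺ G {u} {v} uv≡false u≢v with adj G u v | u ≟ v
  ... | false | no _    = refl
  ... | false | yes u≡v = contradiction u≡v u≢v
  ... | true  | _       = contradiction uv≡false λ ()

  coAdj-true⁻ : ∀ (G : Graph n) {u v} → coAdj G u v ≡ true → adj G u v ≡ false × u ≢ v
  coAdj-true⁻ G {u} {v} co with adj G u v | u ≟ v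
  ... | false | no u≢v = refl , u≢v

  ∈N′co⁺ : ∀ (G : Graph n) {S u v} → v ∈ S → adj G u v ≡ false → u ≢ v → u ∈ N′co G S
  ∈N′co⁺ G v∈S uv≡false u≢v = ∈Partners⁺ (coAdj G) v∈S (coAdj-true⁺ G uv≡false u≢v)

  ∈N′co⁻ : ∀ (G : Graph n) {S u} → u ∈ N′co G S → ∃ λ v → v ∈ S × adj G u v ≡ false × u ≢ v
  ∈N′co⁻ G u∈ with ∈Partners⁻ (coAdj G) u∈
  ... | v , v∈S , co = v , v∈S , coAdj-true⁻ G co

  adj⇒≢ : ∀ (G : Graph n) {u v} → adj G u v ≡ true → u ≢ v
  adj⇒≢ G {u} uv refl = contradiction (trans (sym uv) (irrefl G u)) λ ()

module ExceptionalSets where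

  open Subsets
  open import Data.Nat using (ℕ; _+_; _*_; _≤_)
  import Data.Nat.Properties as ℕP
  open import Data.Fin using (Fin)
  open import Data.Fin.Subset using (Subset; _∈_; _∉_; _∪_; ∣_∣)
  open import Data.Fin.Subset.Properties using (p⊆p∪q; q⊆p∪q)
  open import Data.Product using (_×_; _,_)
  open import Function using (_∘_)

  private variable
    n : ℕ

  record Exceptional (S₁ S₂ : Subset n) (P : Fin n → Fin n → Set) (dW dX : ℕ) : Set where
    field
      W X   : Subset n
      ∣W∣≤  : ∣ W ∣ ≤ dW
      ∣X∣≤  : ∣ X ∣ ≤ dX
      holds : ∀ {u w} → u ∈ S₂ → u ∉ W → w ∈ S₁ → w ∉ X → P u w

  module _ {S₁ S₂ : Subset n} where

    Exceptional-map : ∀ {P Q dW dX} → (∀ {u w} → P u w → Q u w) →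
      Exceptional S₁ S₂ P dW dX → Exceptional S₁ S₂ Q dW dX
    Exceptional-map P⇒Q e = record
      { Exceptional e
      ; holds = λ u∈ u∉ w∈ w∉ → P⇒Q (holds u∈ u∉ w∈ w∉)
      }
      where open Exceptional e

    Exceptional-× : ∀ {P Q dW dX dW′ dX′} →
      Exceptional S₁ S₂ P dW dX → Exceptional S₁ S₂ Q dW′ dX′ →
      Exceptional S₁ S₂ (λ u w → P u w × Q u w) (dW + dW′) (dX + dX′)
    Exceptional-× e f = record
      { W     = E.W ∪ F.W
      ; X     = E.X ∪ F.X
      ; ∣W∣≤  = ℕP.≤-trans (∣p∪q∣≤∣p∣+∣q∣ E.W F.W) (ℕP.+-mono-≤ E.∣W∣≤ F.∣W∣≤)
      ; ∣X∣≤  = ℕP.≤-trans (∣p∪q∣≤∣p∣+∣q∣ E.X F.X) (ℕP.+-mono-≤ E.∣X∣≤ F.∣X∣≤)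
      ; holds = λ u∈ u∉ w∈ w∉ →
          E.holds u∈ (u∉ ∘ p⊆p∪q F.W) w∈ (w∉ ∘ p⊆p∪q F.X) ,
          F.holds u∈ (u∉ ∘ q⊆p∪q E.W F.W) w∈ (w∉ ∘ q⊆p∪q E.X F.X)
      }
      where
      module E = Exceptional e
      module F = Exceptional f

    Exceptional-Π : ∀ k {P : Fin k → Fin n → Fin n → Set} {dW dX} →
      (∀ i → Exceptional S₁ S₂ (P i) dW dX) →
      Exceptional S₁ S₂ (λ u w → ∀ i → P i u w) (k * dW) (k * dX)
    Exceptional-Π k e = record
      { W     = ⋃ᶠ k (W ∘ e)
      ; X     = ⋃ᶠ k (X ∘ e)
      ; ∣W∣≤  = ∣⋃ᶠ∣≤ k (W ∘ e) (∣W∣≤ ∘ e)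
      ; ∣X∣≤  = ∣⋃ᶠ∣≤ k (X ∘ e) (∣X∣≤ ∘ e)
      ; holds = λ u∈ u∉ w∈ w∉ i →
          holds (e i) u∈ (u∉ ∘ ⊆⋃ᶠ k (W ∘ e) i) w∈ (w∉ ∘ ⊆⋃ᶠ k (X ∘ e) i)
      }
      where open Exceptional

module BoxGeometry where

  open import Defs hiding (sym)
  open import Defs using () renaming (sym to adj-sym)
  open Subsets
  open TopSelections
  open Neighbourhoods
  open ExceptionalSets
  open import Data.Bool using (true; false)
  open import Data.Bool.Properties using (¬-not)
  open import Data.Nat using (ℕ; suc; _+_; _*_; _∸_; _≤_; z≤n; s≤s)
  import Data.Nat.Properties as ℕP
  open import Data.Fin using (Fin)
  open import Data.Fin.Subset using (Subset; _∈_; _∉_; _⊆_; _∩_; ∁; ⁅_⁆; ∣_∣; Nonempty)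
  open import Data.Fin.Subset.Properties
  open import Data.Rational as ℚ using (-_)
  import Data.Rational.Properties as ℚP
  open import Algebra.Properties.Group ℚP.+-0-group using (⁻¹-involutive)
  open import Data.Product using (Σ; ∃; _×_; _,_; proj₁; proj₂)
  open import Data.Sum using (inj₁; inj₂)
  open import Function using (_∘_)
  open import Relation.Nullary using (¬_; yes; no; contradiction)
  open import Relation.Binary.PropositionalEquality

  private variable
    n : ℕ

  CrossBound : Graph n → Subset n → Subset n → ℕ → ℕ → Set
  CrossBound G A B t nt = ∀ S → S ⊆ A → ∣ S ∣ ≡ t → nt ≤ ∣ N[ S , G ] ∩ B ∣

  CoBound : Graph n → Subset n → Subset n → ℕ → ℕ → Set
  CoBound G A B t mt = ∀ S → S ⊆ A → ∣ S ∣ ≡ t → mt ≤ ∣ N′co G S ∩ B ∣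

  Covers : Graph n → IntervalRep n → Set
  Covers G I = ∀ {u v} → adj G u v ≡ true → IEdge I u v

  mirror : IntervalRep n → IntervalRep n
  mirror I = record
    { left  = λ u → - right I u
    ; right = λ u → - left I u
    ; wf    = λ u → ℚP.neg-antimono-≤ (wf I u)
    }

  covers-mirror : ∀ {G : Graph n} {I} → Covers G I → Covers G (mirror I)
  covers-mirror covers uv with covers uv
  ... | lu≤rv , lv≤ru = ℚP.neg-antimono-≤ lv≤ru , ℚP.neg-antimono-≤ lu≤rv

  neg-cancel-≤ : ∀ {p q} → - p ℚ.≤ - q → q ℚ.≤ p
  neg-cancel-≤ {p} {q} -p≤-q =
    subst₂ ℚ._≤_ (⁻¹-involutive q) (⁻¹-involutive p) (ℚP.neg-antimono-≤ -p≤-q)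

  module _ {n} (G : Graph n) (S₁ S₂ : Subset n) {t′ nt : ℕ}
           (t≤∣S₁∣ : suc t′ ≤ ∣ S₁ ∣) (cross : CrossBound G S₁ S₂ (suc t′) nt) where

    -- Let C be the t vertices of S₁ with the largest left
    -- endpoints.  Every vertex u ∈ N[C] has its right endpoint beyond the left
    -- endpoint of every w ∈ S₁ except the t-1 upper vertices of C, and at most
    -- |S₂| - nₜ vertices of S₂ lie outside N[C].
    leftEndpointsReached : ∀ I → Covers G I →
      Exceptional S₁ S₂ (λ u w → left I w ℚ.≤ right I u) (∣ S₂ ∣ ∸ nt) t′
    leftEndpointsReached I covers = record
      { W     = ∁ N[ top , G ] ∩ S₂
      ; X     = upper
      ; ∣W∣≤  = ∣W∣≤
      ; ∣X∣≤  = ∣upper∣≤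
      ; holds = reached
      }
      where
      open TopSelection (selectTop (λ w x → left I w ℚ.≤ left I x)
                          (λ w x → ℚP.≤-total (left I w) (left I x)) ℚP.≤-trans S₁ t′ t≤∣S₁∣)
      open ℕP.≤-Reasoning
      N : Subset n
      N = N[ top , G ]
      ∣W∣≤ : ∣ ∁ N ∩ S₂ ∣ ≤ ∣ S₂ ∣ ∸ nt
      ∣W∣≤ = begin
        ∣ ∁ N ∩ S₂ ∣
          ≡⟨ sym (ℕP.m+n∸m≡n ∣ N ∩ S₂ ∣ ∣ ∁ N ∩ S₂ ∣) ⟩
        ∣ N ∩ S₂ ∣ + ∣ ∁ N ∩ S₂ ∣ ∸ ∣ N ∩ S₂ ∣
          ≡⟨ cong (_∸ ∣ N ∩ S₂ ∣) (sym (∣q∣≡∣p∩q∣+∣∁p∩q∣ N S₂)) ⟩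
        ∣ S₂ ∣ ∸ ∣ N ∩ S₂ ∣
          ≤⟨ ℕP.∸-monoʳ-≤ ∣ S₂ ∣ (cross top top⊆A ∣top∣≡) ⟩
        ∣ S₂ ∣ ∸ nt
          ∎
      reached : ∀ {u w} → u ∈ S₂ → u ∉ ∁ N ∩ S₂ → w ∈ S₁ → w ∉ upper → left I w ℚ.≤ right I u
      reached {u} u∈S₂ u∉W w∈S₁ w∉upper with u ∈? N
      ... | no u∉N = contradiction (x∈p∩q⁺ (x∉p⇒x∈∁p u∉N , u∈S₂)) u∉W
      ... | yes u∈N with ∈N[]⁻ G u∈N
      ...   | inj₁ u∈top = ℚP.≤-trans (below-top w∈S₁ w∉upper u∈top) (wf I u)
      ...   | inj₂ (v , v∈top , uv) = ℚP.≤-trans (below-top w∈S₁ w∉upper v∈top) (proj₂ (covers uv))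

    rightEndpointsReached : ∀ I → Covers G I →
      Exceptional S₁ S₂ (λ u w → left I u ℚ.≤ right I w) (∣ S₂ ∣ ∸ nt) t′
    rightEndpointsReached I covers =
      Exceptional-map (λ {u} {w} → neg-cancel-≤ {right I w} {left I u})
        (leftEndpointsReached (mirror I) (covers-mirror {G = G} {I} covers))

    intervalEdgesReached : ∀ I → Covers G I →
      Exceptional S₁ S₂ (IEdge I) ((∣ S₂ ∣ ∸ nt) + (∣ S₂ ∣ ∸ nt)) (t′ + t′)
    intervalEdgesReached I covers =
      Exceptional-× (rightEndpointsReached I covers) (leftEndpointsReached I covers)

    adjacencyReached : ∀ {b} → HasBoxRep G b →
      Exceptional S₁ S₂ (λ u w → u ≢ w → adj G u w ≡ true)
        (b * ((∣ S₂ ∣ ∸ nt) + (∣ S₂ ∣ ∸ nt))) (b * (t′ + t′))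
    adjacencyReached {b} (I , represents) =
      Exceptional-map (λ {u} {w} edges u≢w → proj₂ (represents u w u≢w) edges)
        (Exceptional-Π b (λ i → intervalEdgesReached (I i) (covers i)))
      where
      covers : ∀ i → Covers G (I i)
      covers i {u} {v} uv = proj₁ (represents u v (adj⇒≢ G uv)) uv i

  coExpansion≤ : ∀ (G : Graph n) {S₁ S₂ k mt dW dX} →
    Exceptional S₁ S₂ (λ u w → u ≢ w → adj G u w ≡ true) dW dX →
    CoBound G S₂ S₁ (suc k) mt → suc k + dW ≤ ∣ S₂ ∣ → mt ≤ dX
  coExpansion≤ {n} G {S₁} {S₂} {k} {mt} {dW} {dX} e coBound k+dW≤∣S₂∣ = begin
    mt                  ≤⟨ coBound S (proj₂ ∘ x∈p∩q⁻ (∁ W) S₂ ∘ S⊆T) ∣S∣≡ ⟩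
    ∣ N′co G S ∩ S₁ ∣   ≤⟨ p⊆q⇒∣p∣≤∣q∣ coNeighbours⊆X ⟩
    ∣ X ∣               ≤⟨ ∣X∣≤ ⟩
    dX                  ∎
    where
    open Exceptional e
    open ℕP.≤-Reasoning
    T : Subset n
    T = ∁ W ∩ S₂
    k<∣T∣ : suc k ≤ ∣ T ∣
    k<∣T∣ = ℕP.+-cancelʳ-≤ dW (suc k) ∣ T ∣ (begin
      suc k + dW      ≤⟨ k+dW≤∣S₂∣ ⟩
      ∣ S₂ ∣          ≤⟨ ∣q∣≤∣p∣+∣∁p∩q∣ W S₂ ⟩
      ∣ W ∣ + ∣ T ∣   ≤⟨ ℕP.+-monoˡ-≤ ∣ T ∣ ∣W∣≤ ⟩
      dW + ∣ T ∣      ≡⟨ ℕP.+-comm dW ∣ T ∣ ⟩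
      ∣ T ∣ + dW      ∎)
    chosen : ∃ λ S → S ⊆ T × ∣ S ∣ ≡ suc k
    chosen = subsetOfSize T (suc k) k<∣T∣
    S : Subset n
    S = proj₁ chosen
    S⊆T : S ⊆ T
    S⊆T = proj₁ (proj₂ chosen)
    ∣S∣≡ : ∣ S ∣ ≡ suc k
    ∣S∣≡ = proj₂ (proj₂ chosen)
    coNeighbours⊆X : N′co G S ∩ S₁ ⊆ X
    coNeighbours⊆X {x} x∈ with x ∈? X
    ... | yes x∈X = x∈X
    ... | no x∉X with ∈N′co⁻ G (proj₁ (x∈p∩q⁻ (N′co G S) S₁ x∈))
    ...   | v , v∈S , xv≡false , x≢v =
      contradiction (trans (sym xv≡false) (trans (adj-sym G x v) vx≡true)) λ ()
      where
      v∈T : v ∈ ∁ W × v ∈ S₂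
      v∈T = x∈p∩q⁻ (∁ W) S₂ (S⊆T v∈S)
      vx≡true : adj G v x ≡ true
      vx≡true = holds (proj₂ v∈T) (x∈∁p⇒x∉p (proj₁ v∈T)) (proj₂ (x∈p∩q⁻ (N′co G S) S₁ x∈))
                      x∉X (x≢v ∘ sym)

  coNeighbour : ∀ (G : Graph n) {S₁ S₂ S : Subset n} {v} →
    ¬ (Σ (Fin n) λ u → u ∈ S₂ × (N[ ⁅ u ⁆ , G ] ∩ S₁ ≡ S₁)) →
    v ∈ S₂ → v ∈ S → Nonempty (N′co G S ∩ S₁)
  coNeighbour G {S₁} {S₂} {S} {v} undominated v∈S₂ v∈S with nonempty? (∁ N[ ⁅ v ⁆ , G ] ∩ S₁)
  ... | yes (x , x∈) =
    x , x∈p∩q⁺ (∈N′co⁺ G v∈S xv≡false x≢v , proj₂ (x∈p∩q⁻ (∁ N[ ⁅ v ⁆ , G ]) S₁ x∈))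
    where
    x∉N : x ∉ N[ ⁅ v ⁆ , G ]
    x∉N = x∈∁p⇒x∉p (proj₁ (x∈p∩q⁻ (∁ N[ ⁅ v ⁆ , G ]) S₁ x∈))
    x≢v : x ≢ v
    x≢v refl = x∉N (∈N[]-self G (x∈⁅x⁆ x))
    xv≡false : adj G x v ≡ false
    xv≡false = ¬-not (x∉N ∘ ∈N[]-adj G (x∈⁅x⁆ v))
  ... | no ∁N∩S₁-empty =
    contradiction (v , v∈S₂ , ⊆-antisym (p∩q⊆q N[ ⁅ v ⁆ , G ] S₁) S₁⊆N∩S₁) undominated
    where
    S₁⊆N∩S₁ : S₁ ⊆ N[ ⁅ v ⁆ , G ] ∩ S₁
    S₁⊆N∩S₁ {x} x∈S₁ with x ∈? N[ ⁅ v ⁆ , G ]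
    ... | yes x∈N = x∈p∩q⁺ (x∈N , x∈S₁)
    ... | no x∉N  = contradiction (x , x∈p∩q⁺ (x∉p⇒x∈∁p x∉N , x∈S₁)) ∁N∩S₁-empty

  coExpansion-pos : ∀ (G : Graph n) {S₁ S₂ k mt} →
    ¬ (Σ (Fin n) λ u → u ∈ S₂ × (N[ ⁅ u ⁆ , G ] ∩ S₁ ≡ S₁)) →
    IsMinCo G S₂ S₁ (suc k) mt → 1 ≤ mt
  coExpansion-pos G undominated ((S , S⊆S₂ , ∣S∣≡ , ∣coN∣≡mt) , _)
    with 1≤∣p∣⇒nonempty S (subst (1 ≤_) (sym ∣S∣≡) (s≤s z≤n))
  ... | v , v∈S =
    subst (1 ≤_) ∣coN∣≡mt (x∈p⇒1≤∣p∣ (proj₂ (coNeighbour G undominated (S⊆S₂ v∈S) v∈S)))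

open Arithmetic
open Subsets
open BoxGeometry
open import Data.Nat as ℕ using (zero; suc; z≤n; s≤s)
import Data.Nat.Properties as ℕP
open import Data.Integer.Base using (+_; -[1+_])
open import Data.Rational as ℚ using (0ℚ)
import Data.Rational.Properties as ℚP
open import Data.Fin.Subset.Properties using (∣p∩q∣≤∣q∣)
open import Data.Product using (_,_; proj₂)
open import Relation.Binary.PropositionalEquality as ≡ using (trans; cong; subst; refl)

open import Defs
open import Data.Nat using (ℕ; _≤_)
open import Data.Integer using (ℤ)
open import Data.Rational using (ℚ; 1ℚ; _+_; _-_; _*_)
open import Data.Fin using (Fin)
open import Data.Fin.Subset using (Subset; _∈_; _∪_; _∩_; ⊤; ⁅_⁆; Nonempty; ∣_∣)
open import Data.Product using (Σ; _×_)
open import Relation.Nullary using (¬_)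
open import Relation.Binary.PropositionalEquality using (_≡_)

theorem8 : ∀ {n : ℕ} (G : Graph n) (S₁ S₂ : Subset n) →
    Nonempty S₁ → Nonempty S₂ → S₁ ∪ S₂ ≡ ⊤ →
    ¬ (Σ (Fin n) λ u → u ∈ S₂ × (N[ ⁅ u ⁆ , G ] ∩ S₁ ≡ S₁)) →
    (b : ℕ) → IsBoxicity G b →
    (t : ℕ) → 1 ≤ t → t ≤ ∣ S₁ ∣ →
    (β : ℚ) → IsBeta G S₁ S₂ t β →
    (tstar : ℤ) → ℤtoℚ tstar ≡ ℕtoℚ ∣ S₂ ∣ * (1ℚ - ℕtoℚ 2 * ℕtoℚ b * (1ℚ - β)) →
    (α : ℚ∞) → IsAlpha G S₂ S₁ tstar α →
    1ℚ ÷₀ (ℕtoℚ 2 * (1ℚ - β + extraTerm t α ∣ S₂ ∣)) Data.Rational.≤ ℕtoℚ b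
theorem8 G S₁ S₂ _ (v , v∈S₂) _ undominated b (boxRep , _) (suc t′) (s≤s z≤n) t≤∣S₁∣ β
         (nt , ((Sβ , _ , _ , ∣NSβ∩S₂∣≡nt) , cross) , β≡) tstar tstar≡ α isAlpha =
  ÷₀-lower-bound (ℕtoℚ-nonneg b) (deficit-covered (ℕtoℚ b) β (deficit≤ tstar tstar≡ α isAlpha))
  where
  s twoB : ℚ
  s = ℕtoℚ ∣ S₂ ∣
  twoB = ℕtoℚ 2 * ℕtoℚ b
  0<s : 0ℚ ℚ.< s
  0<s = ℕtoℚ-mono-< (x∈p⇒1≤∣p∣ v∈S₂)
  nt≤∣S₂∣ : nt ≤ ∣ S₂ ∣
  nt≤∣S₂∣ = subst (_≤ ∣ S₂ ∣) ∣NSβ∩S₂∣≡nt (∣p∩q∣≤∣q∣ N[ Sβ , G ] S₂)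
  βs≡nt : β * s ≡ ℕtoℚ nt
  βs≡nt = trans (cong (_* s) β≡) (÷₀-cancel (ℕtoℚ nt) (>⇒≢0 0<s))
  -- the deficit 1 - 2b(1 - β) = t*/|S₂| is covered, by cases on the sign of t*
  deficit≤ : ∀ tstar → ℤtoℚ tstar ≡ s * (1ℚ - twoB * (1ℚ - β)) → ∀ α → IsAlpha G S₂ S₁ tstar α →
    1ℚ - twoB * (1ℚ - β) ℚ.≤ twoB * extraTerm (suc t′) α ∣ S₂ ∣
  deficit≤ (+ zero) 0≡sc .∞ refl = nonpos-factor twoB 0<s (ℚP.≤-reflexive (≡.sym 0≡sc))
  deficit≤ -[1+ m ] t≡sc .∞ refl =
    nonpos-factor twoB 0<s (subst (ℚ._≤ 0ℚ) t≡sc (ℚP.neg-antimono-≤ (ℕtoℚ-nonneg (suc m))))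
  deficit≤ (+ suc k) k≡sc _ (mt , minCo , refl) =
    deficit-by-quotient twoB (ℕtoℚ t′) 0<s (ℕtoℚ-mono-< {0} {suc k} (s≤s z≤n))
      (ℕtoℚ-mono-< (coExpansion-pos G undominated minCo)) k≡sc
      (subst (ℕtoℚ mt ℚ.≤_) (ℕtoℚ-*-double b t′) (ℕtoℚ-mono-≤ mt≤))
    where
    mt≤ : mt ≤ b ℕ.* (t′ ℕ.+ t′)
    mt≤ = coExpansion≤ G (adjacencyReached G S₁ S₂ t≤∣S₁∣ cross boxRep) (proj₂ minCo)
            (ℕP.≤-reflexive (tstar-natural (suc k) ∣ S₂ ∣ b nt β nt≤∣S₂∣ βs≡nt k≡sc))
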